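{- Let $k,s$ be positive integers, let $H=(A,B;E)$ be a bipartite graph in which every vertex of $B$ has degree at most $k$, and write $a=|A|$, $b=|B|$. Let $G$ be a graph not containing $K_{s,s}$ as a subgraph. If $G$ contains a rich independent set of size $a$, then $G$ contains $H$ as an induced subgraph.
   Context: A set $S\subseteq V(G)$ is called rich (with respect to $k$, $b$, $s$) if for every $T\subseteq S$ with $|T|\le k$, $$\big|\{v\in V(G)\setminus S:\ N(v)\cap S=T\}\big|\ge (4bs)^b,$$ where $N(v)$ is the neighbourhood of $v$ in $G$. -}

module Defs where

open import Data.Nat using (ℕ; _≤_; _*_; _^_)
open import Data.Bool using (Bool; true; false; _∧_; not)
open import Data.Bool.Properties using () renaming (_≟_ to _≟ᵇ_)
open import Data.Fin using (Fin)
open import Data.Fin.Subset using (Subset; _∈_; _∉_; _⊆_; ∣_∣)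
open import Data.Vec using (Vec; tabulate; lookup)
open import Data.Vec.Properties using (≡-dec)
open import Data.Sum using (_⊎_)
open import Data.Product using (Σ; _×_; ∃-syntax)
open import Function.Definitions using (Injective)
open import Relation.Nullary using (¬_)
open import Relation.Nullary.Decidable using (⌊_⌋)
open import Relation.Binary.PropositionalEquality using (_≡_)

record Graph : Set where
  field
    n     : ℕ
    adj   : Fin n → Fin n → Bool
    sym   : ∀ u v → adj u v ≡ adj v u
    irref : ∀ v → adj v v ≡ false
open Graph public

record Bipartite : Set where
  field
    a : ℕ
    b : ℕ
    E : Fin a → Fin b → Bool
open Bipartite public

degB : (H : Bipartite) → Fin (b H) → ℕ
degB H j = ∣ tabulate (λ i → E H i j) ∣

nbrIn : (G : Graph) → Subset (n G) → Fin (n G) → Subset (n G)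
nbrIn G S v = tabulate (λ u → adj G v u ∧ lookup S u)

countWitnesses : (G : Graph) → Subset (n G) → Subset (n G) → ℕ
countWitnesses G S T =
  ∣ tabulate (λ v → not (lookup S v) ∧ ⌊ ≡-dec _≟ᵇ_ (nbrIn G S v) T ⌋) ∣

Rich : (G : Graph) → (k b s : ℕ) → Subset (n G) → Set
Rich G k b s S =
  (T : Subset (n G)) → T ⊆ S → ∣ T ∣ ≤ k →
  (4 * b * s) ^ b ≤ countWitnesses G S T

Independent : (G : Graph) → Subset (n G) → Set
Independent G S = ∀ u v → u ∈ S → v ∈ S → adj G u v ≡ false

ContainsKss : (G : Graph) → ℕ → Set
ContainsKss G s =
  Σ (Fin s ⊎ Fin s → Fin (n G)) λ f →
    Injective _≡_ _≡_ f ×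
    (∀ (i j : Fin s) → adj G (f (Data.Sum.inj₁ i)) (f (Data.Sum.inj₂ j)) ≡ true)

ContainsInduced : (G : Graph) → (H : Bipartite) → Set
ContainsInduced G H =
  Σ (Fin (a H) ⊎ Fin (b H) → Fin (n G)) λ f →
    Injective _≡_ _≡_ f ×
    (∀ i i' → adj G (f (Data.Sum.inj₁ i)) (f (Data.Sum.inj₁ i')) ≡ false) ×
    (∀ j j' → adj G (f (Data.Sum.inj₂ j)) (f (Data.Sum.inj₂ j')) ≡ false) ×
    (∀ i j → adj G (f (Data.Sum.inj₁ i)) (f (Data.Sum.inj₂ j)) ≡ E H i j)

-- The vertices of A are the vertices of S; a vertex j of B is embedded as a vertex
-- outside S whose neighbourhood in S is the image of N_H(j), and richness gives at
-- least c^b candidates for each j, where c = 4bs. It remains to pick one candidate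
-- per j, pairwise distinct and non-adjacent. Greedily, with r candidate sets of size
-- at least c^r: call v in the first set good if it has more than c^(r-1)
-- non-neighbours in each other set. For a fixed other set fewer than s vertices fail,
-- since s failing vertices miss at most s·c^(r-1) of its at least c^r ≥ s + s·c^(r-1)
-- vertices and so have s common neighbours, a K_{s,s}. Hence some v is good, and we
-- recurse on the other sets with v and its neighbours removed.
module Submission where

open import Defs hiding (sym)
open import Data.Bool using (Bool; true; false; _∧_; not)
open import Data.Bool.Properties using (∧-identityʳ) renaming (_≟_ to _≟ᵇ_)
open import Data.Empty using (⊥-elim)
open import Data.Fin using (Fin; zero; suc; inject≤)
open import Data.Fin.Properties using (inject≤-injective; suc-injective)
open import Data.Fin.Subset
  using (Subset; inside; outside; _∈_; _∉_; _⊆_; _∩_; _─_; _-_; ⁅_⁆; ⋂; ∣_∣)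
open import Data.Fin.Subset.Properties
  using (x∈p∩q⁻; ∣p∩q∣≤∣p∣; ∣p∩q∣≤∣q∣; ∣⁅x⁆∣≡1; x∈⁅x⁆; p─q⊆p; ∩-assoc; ∩-identityʳ)
import Data.List as List
open import Data.Nat using (ℕ; zero; suc; _+_; _*_; _^_; _≤_; _<_; _>_; s≤s; z≤n; NonZero; >-nonZero; _≤?_; _<?_)
open import Data.Nat.Properties
  using (+-suc; +-assoc; +-comm; +-identityʳ; +-mono-≤; +-monoˡ-≤; +-cancelʳ-≤; +-cancelʳ-<;
         *-assoc; *-monoˡ-≤; *-monoˡ-<; m≤m*n; m≤n*m; m*n≢0; m^n≢0;
         ≤-refl; ≤-reflexive; ≤-trans; ≤-pred; <⇒≤; <-≤-trans; ≰⇒>; ≮⇒≥; module ≤-Reasoning)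
open import Data.Product using (Σ; _×_; _,_; proj₁; proj₂)
open import Data.Sum using (_⊎_; inj₁; inj₂)
open import Data.Vec using ([]; _∷_; here; there; lookup; tabulate)
open import Data.Vec.Properties using (lookup∘tabulate; []=⇒lookup; lookup⇒[]=; ≡-dec)
open import Function using (_∘_; case_of_)
open import Function.Definitions using (Injective)
open import Relation.Nullary using (¬_; Dec; yes; no)
open import Relation.Nullary.Decidable using (⌊_⌋)
open import Relation.Binary.PropositionalEquality
  using (_≡_; _≢_; refl; sym; trans; cong; subst; module ≡-Reasoning)

∈-tabulate⁺ : ∀ {m} {P : Fin m → Bool} {x} → P x ≡ true → x ∈ tabulate P
∈-tabulate⁺ {P = P} {x} Px = lookup⇒[]= x (tabulate P) (trans (lookup∘tabulate P x) Px)

∈-tabulate⁻ : ∀ {m} {P : Fin m → Bool} {x} → x ∈ tabulate P → P x ≡ true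
∈-tabulate⁻ {P = P} {x} x∈ = trans (sym (lookup∘tabulate P x)) ([]=⇒lookup x∈)

∉-tabulate⁻ : ∀ {m} {P : Fin m → Bool} {x} → x ∉ tabulate P → P x ≡ false
∉-tabulate⁻ {P = P} {x} x∉ with P x in Px
... | true  = ⊥-elim (x∉ (∈-tabulate⁺ Px))
... | false = refl

x∈p─q⇒x∉q : ∀ {m x} {p q : Subset m} → x ∈ p ─ q → x ∉ q
x∈p─q⇒x∉q {p = _ ∷ p} {outside ∷ q} here       ()
x∈p─q⇒x∉q {p = _ ∷ p} {_ ∷ q}       (there x∈) (there x∈q) = x∈p─q⇒x∉q x∈ x∈q

x∈p-y⇒x≢y : ∀ {m x y} {p : Subset m} → x ∈ p - y → x ≢ y
x∈p-y⇒x≢y {y = y} x∈ refl = x∈p─q⇒x∉q x∈ (x∈⁅x⁆ y)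

∣p∣≡∣p∩q∣+∣p─q∣ : ∀ {m} (p q : Subset m) → ∣ p ∣ ≡ ∣ p ∩ q ∣ + ∣ p ─ q ∣
∣p∣≡∣p∩q∣+∣p─q∣ []            []            = refl
∣p∣≡∣p∩q∣+∣p─q∣ (inside  ∷ p) (inside  ∷ q) = cong suc (∣p∣≡∣p∩q∣+∣p─q∣ p q)
∣p∣≡∣p∩q∣+∣p─q∣ (inside  ∷ p) (outside ∷ q) =
  trans (cong suc (∣p∣≡∣p∩q∣+∣p─q∣ p q)) (sym (+-suc _ _))
∣p∣≡∣p∩q∣+∣p─q∣ (outside ∷ p) (inside  ∷ q) = ∣p∣≡∣p∩q∣+∣p─q∣ p q
∣p∣≡∣p∩q∣+∣p─q∣ (outside ∷ p) (outside ∷ q) = ∣p∣≡∣p∩q∣+∣p─q∣ p q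

p∩q─r≡p─r∩q : ∀ {m} (p q r : Subset m) → p ∩ q ─ r ≡ (p ─ r) ∩ q
p∩q─r≡p─r∩q []      []      []            = refl
p∩q─r≡p─r∩q (x ∷ p) (y ∷ q) (inside  ∷ r) = cong (outside ∷_) (p∩q─r≡p─r∩q p q r)
p∩q─r≡p─r∩q (x ∷ p) (y ∷ q) (outside ∷ r) = cong (x ∧ y ∷_) (p∩q─r≡p─r∩q p q r)

∣p∩q─r∣≤∣p─r∣ : ∀ {m} (p q r : Subset m) → ∣ p ∩ q ─ r ∣ ≤ ∣ p ─ r ∣
∣p∩q─r∣≤∣p─r∣ p q r =
  subst (λ t → ∣ t ∣ ≤ ∣ p ─ r ∣) (sym (p∩q─r≡p─r∩q p q r)) (∣p∩q∣≤∣p∣ (p ─ r) q)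

∣p∣≤1+∣p-x∣ : ∀ {m} (p : Subset m) x → ∣ p ∣ ≤ suc ∣ p - x ∣
∣p∣≤1+∣p-x∣ p x = begin
  ∣ p ∣                         ≡⟨ ∣p∣≡∣p∩q∣+∣p─q∣ p ⁅ x ⁆ ⟩
  ∣ p ∩ ⁅ x ⁆ ∣ + ∣ p - x ∣     ≤⟨ +-monoˡ-≤ ∣ p - x ∣ (∣p∩q∣≤∣q∣ p ⁅ x ⁆) ⟩
  ∣ ⁅ x ⁆ ∣ + ∣ p - x ∣         ≡⟨ cong (_+ ∣ p - x ∣) (∣⁅x⁆∣≡1 x) ⟩
  suc ∣ p - x ∣                 ∎
  where open ≤-Reasoning

x∈⋂⁻ : ∀ {m r} {x : Fin m} (q : Fin r → Subset m) →
       x ∈ ⋂ (List.tabulate q) → ∀ i → x ∈ q i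
x∈⋂⁻ q x∈ zero    = proj₁ (x∈p∩q⁻ (q zero) _ x∈)
x∈⋂⁻ q x∈ (suc i) = x∈⋂⁻ (q ∘ suc) (proj₂ (x∈p∩q⁻ (q zero) _ x∈)) i

∣p∣≤∣p∩⋂q∣+r*δ : ∀ {m} r (p : Subset m) (q : Fin r → Subset m) {δ} →
                 (∀ i → ∣ p ─ q i ∣ ≤ δ) →
                 ∣ p ∣ ≤ ∣ p ∩ ⋂ (List.tabulate q) ∣ + r * δ
∣p∣≤∣p∩⋂q∣+r*δ zero p q _ = ≤-reflexive (begin
  ∣ p ∣                       ≡⟨ cong ∣_∣ (sym (∩-identityʳ p)) ⟩
  ∣ p ∩ ⋂ List.[] ∣           ≡⟨ sym (+-identityʳ _) ⟩
  ∣ p ∩ ⋂ List.[] ∣ + 0       ∎)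
  where open ≡-Reasoning
∣p∣≤∣p∩⋂q∣+r*δ (suc r) p q {δ} small = begin
  ∣ p ∣                                ≡⟨ ∣p∣≡∣p∩q∣+∣p─q∣ p (q zero) ⟩
  ∣ p ∩ q zero ∣ + ∣ p ─ q zero ∣      ≤⟨ +-mono-≤ ih (small zero) ⟩
  (∣ (p ∩ q zero) ∩ ⋂qs ∣ + r * δ) + δ ≡⟨ cong (λ t → (∣ t ∣ + r * δ) + δ) (∩-assoc p (q zero) ⋂qs) ⟩
  (∣ p ∩ q zero ∩ ⋂qs ∣ + r * δ) + δ   ≡⟨ +-assoc _ (r * δ) δ ⟩
  ∣ p ∩ q zero ∩ ⋂qs ∣ + (r * δ + δ)   ≡⟨ cong (∣ p ∩ q zero ∩ ⋂qs ∣ +_) (+-comm (r * δ) δ) ⟩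
  ∣ p ∩ q zero ∩ ⋂qs ∣ + suc r * δ     ∎
  where
  open ≤-Reasoning
  ⋂qs : Subset _
  ⋂qs = ⋂ (List.tabulate (q ∘ suc))
  ih : ∣ p ∩ q zero ∣ ≤ ∣ (p ∩ q zero) ∩ ⋂qs ∣ + r * δ
  ih = ∣p∣≤∣p∩⋂q∣+r*δ r (p ∩ q zero) (q ∘ suc)
         (λ i → ≤-trans (∣p∩q─r∣≤∣p─r∣ p (q zero) (q (suc i))) (small (suc i)))

enum : ∀ {m} (p : Subset m) → Fin ∣ p ∣ → Fin m
enum (inside  ∷ p) zero    = zero
enum (inside  ∷ p) (suc i) = suc (enum p i)
enum (outside ∷ p) i       = suc (enum p i)

enum-∈ : ∀ {m} (p : Subset m) i → enum p i ∈ p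
enum-∈ (inside  ∷ p) zero    = here
enum-∈ (inside  ∷ p) (suc i) = there (enum-∈ p i)
enum-∈ (outside ∷ p) i       = there (enum-∈ p i)

enum-injective : ∀ {m} (p : Subset m) → Injective _≡_ _≡_ (enum p)
enum-injective (inside  ∷ p) {zero}  {zero}  _  = refl
enum-injective (inside  ∷ p) {suc i} {suc j} eq = cong suc (enum-injective p (suc-injective eq))
enum-injective (outside ∷ p)                 eq = enum-injective p (suc-injective eq)

select : ∀ {m s} (p : Subset m) → s ≤ ∣ p ∣ → Fin s → Fin m
select p s≤∣p∣ i = enum p (inject≤ i s≤∣p∣)

select-∈ : ∀ {m s} (p : Subset m) (s≤∣p∣ : s ≤ ∣ p ∣) i → select p s≤∣p∣ i ∈ p
select-∈ p s≤∣p∣ i = enum-∈ p (inject≤ i s≤∣p∣)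

select-injective : ∀ {m s} (p : Subset m) (s≤∣p∣ : s ≤ ∣ p ∣) → Injective _≡_ _≡_ (select p s≤∣p∣)
select-injective p s≤∣p∣ eq = inject≤-injective s≤∣p∣ s≤∣p∣ _ _ (enum-injective p eq)

-- The subset of p whose i-th element, in the order of enum p, belongs to it iff i ∈ q.
expand : ∀ {m} (p : Subset m) → Subset ∣ p ∣ → Subset m
expand []            []      = []
expand (inside  ∷ p) (x ∷ q) = x ∷ expand p q
expand (outside ∷ p) q       = outside ∷ expand p q

expand-⊆ : ∀ {m} (p : Subset m) q → expand p q ⊆ p
expand-⊆ (inside  ∷ p) (inside ∷ q) here       = here
expand-⊆ (inside  ∷ p) (_ ∷ q)      (there x∈) = there (expand-⊆ p q x∈)
expand-⊆ (outside ∷ p) q            (there x∈) = there (expand-⊆ p q x∈)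

∣expand∣ : ∀ {m} (p : Subset m) q → ∣ expand p q ∣ ≡ ∣ q ∣
∣expand∣ []            []            = refl
∣expand∣ (inside  ∷ p) (inside  ∷ q) = cong suc (∣expand∣ p q)
∣expand∣ (inside  ∷ p) (outside ∷ q) = ∣expand∣ p q
∣expand∣ (outside ∷ p) q             = ∣expand∣ p q

lookup-expand-enum : ∀ {m} (p : Subset m) q i → lookup (expand p q) (enum p i) ≡ lookup q i
lookup-expand-enum (inside  ∷ p) (_ ∷ q) zero    = refl
lookup-expand-enum (inside  ∷ p) (_ ∷ q) (suc i) = lookup-expand-enum p q i
lookup-expand-enum (outside ∷ p) q       i       = lookup-expand-enum p q i

⌊⌋≡true⇒ : ∀ {a} {A : Set a} (a? : Dec A) → ⌊ a? ⌋ ≡ true → A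
⌊⌋≡true⇒ (yes a) _ = a

⌊⌋≡false⇒¬ : ∀ {a} {A : Set a} (a? : Dec A) → ⌊ a? ⌋ ≡ false → ¬ A
⌊⌋≡false⇒¬ (no ¬a) _ = ¬a

s+s*X≤4bs*X : ∀ b s X .{{_ : NonZero b}} .{{_ : NonZero X}} → s + s * X ≤ 4 * b * s * X
s+s*X≤4bs*X b s X = begin
  s + s * X           ≤⟨ +-monoˡ-≤ (s * X) (m≤m*n s X) ⟩
  s * X + s * X       ≡⟨ cong (s * X +_) (sym (+-identityʳ (s * X))) ⟩
  2 * (s * X)         ≤⟨ *-monoˡ-≤ (s * X) (≤-trans (s≤s (s≤s z≤n)) (m≤m*n 4 b)) ⟩
  4 * b * (s * X)     ≡⟨ sym (*-assoc (4 * b) s X) ⟩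
  4 * b * s * X       ∎
  where open ≤-Reasoning

r*s<4bs*X : ∀ {r b} s X .{{_ : NonZero s}} .{{_ : NonZero X}} → r < b → r * s < 4 * b * s * X
r*s<4bs*X {r} {b} s X r<b = begin-strict
  r * s               <⟨ *-monoˡ-< s r<b ⟩
  b * s               ≤⟨ m≤n*m (b * s) 4 ⟩
  4 * (b * s)         ≡⟨ sym (*-assoc 4 b s) ⟩
  4 * b * s           ≤⟨ m≤m*n (4 * b * s) X ⟩
  4 * b * s * X       ∎
  where open ≤-Reasoning

nbrs : (G : Graph) → Fin (n G) → Subset (n G)
nbrs G v = tabulate (adj G v)

crossAdjacent⇒ContainsKss : ∀ (G : Graph) {s} (d e : Fin s → Fin (n G)) →
  Injective _≡_ _≡_ d → Injective _≡_ _≡_ e →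
  (∀ i j → adj G (d i) (e j) ≡ true) → ContainsKss G s
crossAdjacent⇒ContainsKss G d e d-inj e-inj d~e = f , f-inj , d~e
  where
  f : _ ⊎ _ → Fin (n G)
  f (inj₁ i) = d i
  f (inj₂ j) = e j
  d≢e : ∀ i j → d i ≢ e j
  d≢e i j di≡ej with trans (sym (d~e i j)) (trans (cong (adj G (d i)) (sym di≡ej)) (irref G (d i)))
  ... | ()
  f-inj : Injective _≡_ _≡_ f
  f-inj {inj₁ i} {inj₁ i′} eq = cong inj₁ (d-inj eq)
  f-inj {inj₁ i} {inj₂ j}  eq = ⊥-elim (d≢e i j eq)
  f-inj {inj₂ j} {inj₁ i}  eq = ⊥-elim (d≢e i j (sym eq))
  f-inj {inj₂ j} {inj₂ j′} eq = cong inj₂ (e-inj eq)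

fewNonNeighbours⇒ContainsKss : ∀ (G : Graph) {s X} (Q : Subset (n G)) (d : Fin s → Fin (n G)) →
  Injective _≡_ _≡_ d → (∀ i → ∣ Q ─ nbrs G (d i) ∣ ≤ X) → s + s * X ≤ ∣ Q ∣ →
  ContainsKss G s
fewNonNeighbours⇒ContainsKss G {s} {X} Q d d-inj sparse big =
  crossAdjacent⇒ContainsKss G d e d-inj (select-injective common s≤∣common∣) d~e
  where
  common : Subset (n G)
  common = Q ∩ ⋂ (List.tabulate (nbrs G ∘ d))
  s≤∣common∣ : s ≤ ∣ common ∣
  s≤∣common∣ = +-cancelʳ-≤ (s * X) s ∣ common ∣
    (≤-trans big (∣p∣≤∣p∩⋂q∣+r*δ s Q (nbrs G ∘ d) sparse))
  e : Fin s → Fin (n G)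
  e = select common s≤∣common∣
  d~e : ∀ i j → adj G (d i) (e j) ≡ true
  d~e i j = ∈-tabulate⁻ (x∈⋂⁻ (nbrs G ∘ d) (proj₂ (x∈p∩q⁻ Q _ (select-∈ common s≤∣common∣ j))) i)

record IndependentTransversal (G : Graph) {r} (W : Fin r → Subset (n G)) : Set where
  field
    rep             : Fin r → Fin (n G)
    rep-∈           : ∀ j → rep j ∈ W j
    rep-injective   : Injective _≡_ _≡_ rep
    rep-independent : ∀ i j → adj G (rep i) (rep j) ≡ false

extendTransversal : ∀ (G : Graph) {r} (W : Fin (suc r) → Subset (n G)) {v} → v ∈ W zero →
  IndependentTransversal G (λ j → W (suc j) ─ nbrs G v - v) →
  IndependentTransversal G W
extendTransversal G W {v} v∈W₀ T = record
  { rep = rep′ ; rep-∈ = rep′-∈ ; rep-injective = rep′-inj ; rep-independent = rep′-indep }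
  where
  open IndependentTransversal T
  rep′ : Fin (suc _) → Fin (n G)
  rep′ zero    = v
  rep′ (suc j) = rep j
  rep≢v : ∀ j → rep j ≢ v
  rep≢v j = x∈p-y⇒x≢y (rep-∈ j)
  v≁rep : ∀ j → adj G v (rep j) ≡ false
  v≁rep j = ∉-tabulate⁻ (x∈p─q⇒x∉q (p─q⊆p _ ⁅ v ⁆ (rep-∈ j)))
  rep′-∈ : ∀ j → rep′ j ∈ W j
  rep′-∈ zero    = v∈W₀
  rep′-∈ (suc j) = p─q⊆p _ (nbrs G v) (p─q⊆p _ ⁅ v ⁆ (rep-∈ j))
  rep′-inj : Injective _≡_ _≡_ rep′
  rep′-inj {zero}  {zero}  _  = refl
  rep′-inj {zero}  {suc j} eq = ⊥-elim (rep≢v j (sym eq))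
  rep′-inj {suc i} {zero}  eq = ⊥-elim (rep≢v i eq)
  rep′-inj {suc i} {suc j} eq = cong suc (rep-injective eq)
  rep′-indep : ∀ i j → adj G (rep′ i) (rep′ j) ≡ false
  rep′-indep zero    zero    = irref G v
  rep′-indep zero    (suc j) = v≁rep j
  rep′-indep (suc i) zero    = trans (Graph.sym G (rep i) v) (v≁rep i)
  rep′-indep (suc i) (suc j) = rep-independent i j

module _ (G : Graph) {s} .{{_ : NonZero s}} (Kss-free : ¬ ContainsKss G s) where

  manyNonNeighbours : ℕ → Subset (n G) → Subset (n G)
  manyNonNeighbours X Q = tabulate (λ v → ⌊ X <? ∣ Q ─ nbrs G v ∣ ⌋)

  ∣P─manyNonNeighbours∣<s : ∀ {X} (P Q : Subset (n G)) → s + s * X ≤ ∣ Q ∣ →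
    ∣ P ─ manyNonNeighbours X Q ∣ < s
  ∣P─manyNonNeighbours∣<s {X} P Q big with s ≤? ∣ P ─ manyNonNeighbours X Q ∣
  ... | no  s≰ = ≰⇒> s≰
  ... | yes s≤ = ⊥-elim (Kss-free
      (fewNonNeighbours⇒ContainsKss G Q d (select-injective (P ─ manyNonNeighbours X Q) s≤) sparse big))
    where
    d : Fin s → Fin (n G)
    d = select (P ─ manyNonNeighbours X Q) s≤
    sparse : ∀ i → ∣ Q ─ nbrs G (d i) ∣ ≤ X
    sparse i = ≮⇒≥ (⌊⌋≡false⇒¬ (X <? ∣ Q ─ nbrs G (d i) ∣)
                 (∉-tabulate⁻ (x∈p─q⇒x∉q (select-∈ (P ─ manyNonNeighbours X Q) s≤ i))))

  goodVertex : ∀ {r X} (W : Fin (suc r) → Subset (n G)) →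
    (∀ j → s + s * X ≤ ∣ W (suc j) ∣) → r * s < ∣ W zero ∣ →
    Σ (Fin (n G)) λ v → v ∈ W zero × (∀ j → X < ∣ W (suc j) ─ nbrs G v ∣)
  goodVertex {r} {X} W big₊ big₀ = v , v∈W₀ , v-far
    where
    far : Fin r → Subset (n G)
    far j = manyNonNeighbours X (W (suc j))
    good : Subset (n G)
    good = W zero ∩ ⋂ (List.tabulate far)
    1≤∣good∣ : 1 ≤ ∣ good ∣
    1≤∣good∣ = +-cancelʳ-< (r * s) 0 ∣ good ∣ (<-≤-trans big₀
      (∣p∣≤∣p∩⋂q∣+r*δ r (W zero) far
        (λ j → <⇒≤ (∣P─manyNonNeighbours∣<s (W zero) (W (suc j)) (big₊ j)))))
    v : Fin (n G)
    v = select good 1≤∣good∣ zero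
    v∈ : v ∈ W zero × v ∈ ⋂ (List.tabulate far)
    v∈ = x∈p∩q⁻ (W zero) _ (select-∈ good 1≤∣good∣ zero)
    v∈W₀ : v ∈ W zero
    v∈W₀ = proj₁ v∈
    v-far : ∀ j → X < ∣ W (suc j) ─ nbrs G v ∣
    v-far j = ⌊⌋≡true⇒ (X <? _) (∈-tabulate⁻ (x∈⋂⁻ far (proj₂ v∈) j))

  independentTransversal : ∀ {b r} → r ≤ b → (W : Fin r → Subset (n G)) →
    (∀ j → (4 * b * s) ^ r ≤ ∣ W j ∣) → IndependentTransversal G W
  independentTransversal {r = zero} _ W _ = record
    { rep = λ () ; rep-∈ = λ () ; rep-injective = λ { {()} } ; rep-independent = λ () }
  independentTransversal {b} {suc r} r<b W big =
    extendTransversal G W v∈W₀ (independentTransversal (<⇒≤ r<b) W′ big′)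
    where
    instance
      b≢0 : NonZero b
      b≢0 = >-nonZero (≤-trans (s≤s z≤n) r<b)
      X≢0 : NonZero ((4 * b * s) ^ r)
      X≢0 = m^n≢0 (4 * b * s) r {{m*n≢0 (4 * b) s {{m*n≢0 4 b}}}}
    X : ℕ
    X = (4 * b * s) ^ r
    chosen : Σ (Fin (n G)) λ v → v ∈ W zero × (∀ j → X < ∣ W (suc j) ─ nbrs G v ∣)
    chosen = goodVertex W (λ j → ≤-trans (s+s*X≤4bs*X b s X) (big (suc j)))
                          (<-≤-trans (r*s<4bs*X s X r<b) (big zero))
    v : Fin (n G)
    v = proj₁ chosen
    v∈W₀ : v ∈ W zero
    v∈W₀ = proj₁ (proj₂ chosen)
    W′ : Fin r → Subset (n G)
    W′ j = W (suc j) ─ nbrs G v - v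
    big′ : ∀ j → X ≤ ∣ W′ j ∣
    big′ j = ≤-pred (≤-trans (proj₂ (proj₂ chosen) j) (∣p∣≤1+∣p-x∣ (W (suc j) ─ nbrs G v) v))

witnesses : (G : Graph) → Subset (n G) → Subset (n G) → Subset (n G)
witnesses G S T = tabulate (λ v → not (lookup S v) ∧ ⌊ ≡-dec _≟ᵇ_ (nbrIn G S v) T ⌋)

∈-witnesses⁻ : ∀ (G : Graph) S T {v} → v ∈ witnesses G S T → v ∉ S × nbrIn G S v ≡ T
∈-witnesses⁻ G S T {v} v∈ with lookup S v in Sv | ≡-dec _≟ᵇ_ (nbrIn G S v) T | ∈-tabulate⁻ v∈
... | true  | _        | ()
... | false | no _     | ()
... | false | yes N≡T  | _ = (λ v∈S → case trans (sym ([]=⇒lookup v∈S)) Sv of λ ()) , N≡T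

lookup-nbrIn : ∀ (G : Graph) {S u} v → u ∈ S → lookup (nbrIn G S v) u ≡ adj G v u
lookup-nbrIn G {S} {u} v u∈S = begin
  lookup (nbrIn G S v) u      ≡⟨ lookup∘tabulate (λ w → adj G v w ∧ lookup S w) u ⟩
  adj G v u ∧ lookup S u      ≡⟨ cong (adj G v u ∧_) ([]=⇒lookup u∈S) ⟩
  adj G v u ∧ true            ≡⟨ ∧-identityʳ (adj G v u) ⟩
  adj G v u                   ∎
  where open ≡-Reasoning

column : ∀ {a b} → (Fin a → Fin b → Bool) → Fin b → Subset a
column E j = tabulate (λ i → E i j)

inducedCopy : ∀ (G : Graph) (S : Subset (n G)) {b} (E : Fin ∣ S ∣ → Fin b → Bool) →
  Independent G S →
  IndependentTransversal G (λ j → witnesses G S (expand S (column E j))) →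
  ContainsInduced G (record { a = ∣ S ∣ ; b = b ; E = E })
inducedCopy G S E S-indep T = f , f-inj , A-indep , rep-independent , A~B
  where
  open IndependentTransversal T
  f : Fin ∣ S ∣ ⊎ Fin _ → Fin (n G)
  f (inj₁ i) = enum S i
  f (inj₂ j) = rep j
  enum≢rep : ∀ i j → enum S i ≢ rep j
  enum≢rep i j eq = proj₁ (∈-witnesses⁻ G S _ (rep-∈ j)) (subst (_∈ S) eq (enum-∈ S i))
  f-inj : Injective _≡_ _≡_ f
  f-inj {inj₁ i} {inj₁ i′} eq = cong inj₁ (enum-injective S eq)
  f-inj {inj₁ i} {inj₂ j}  eq = ⊥-elim (enum≢rep i j eq)
  f-inj {inj₂ j} {inj₁ i}  eq = ⊥-elim (enum≢rep i j (sym eq))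
  f-inj {inj₂ j} {inj₂ j′} eq = cong inj₂ (rep-injective eq)
  A-indep : ∀ i i′ → adj G (enum S i) (enum S i′) ≡ false
  A-indep i i′ = S-indep _ _ (enum-∈ S i) (enum-∈ S i′)
  A~B : ∀ i j → adj G (enum S i) (rep j) ≡ E i j
  A~B i j = begin
    adj G (enum S i) (rep j)                          ≡⟨ Graph.sym G (enum S i) (rep j) ⟩
    adj G (rep j) (enum S i)                          ≡⟨ lookup-nbrIn G (rep j) (enum-∈ S i) ⟨
    lookup (nbrIn G S (rep j)) (enum S i)             ≡⟨ cong (λ t → lookup t (enum S i)) (proj₂ (∈-witnesses⁻ G S _ (rep-∈ j))) ⟩
    lookup (expand S (column E j)) (enum S i)         ≡⟨ lookup-expand-enum S (column E j) i ⟩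
    lookup (column E j) i                             ≡⟨ lookup∘tabulate (λ i → E i j) i ⟩
    E i j                                             ∎
    where open ≡-Reasoning

lemma2p3 : (k s : ℕ) → k > 0 → s > 0 →
    (H : Bipartite) → (∀ j → degB H j ≤ k) →
    (G : Graph) → ¬ ContainsKss G s →
    (Σ (Subset (n G)) λ S → Rich G k (b H) s S × Independent G S × ∣ S ∣ ≡ a H) →
    ContainsInduced G H
lemma2p3 k s _ s>0 record { a = _ ; b = b ; E = E } deg≤k G Kss-free (S , rich , S-indep , refl) =
  inducedCopy G S E S-indep (independentTransversal G Kss-free ≤-refl W W-large)
  where
  instance
    s≢0 : NonZero s
    s≢0 = >-nonZero s>0
  W : Fin b → Subset (n G)
  W j = witnesses G S (expand S (column E j))
  W-large : ∀ j → (4 * b * s) ^ b ≤ ∣ W j ∣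
  W-large j = rich (expand S (column E j)) (expand-⊆ S (column E j))
                   (≤-trans (≤-reflexive (∣expand∣ S (column E j))) (deg≤k j))
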